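{- In a token swapping instance on a graph, an optimal (minimum length) sorting swap sequence never contains two swaps that exchange the same two tokens.
   Context: Token swapping: a graph has vertices $v_1,\dots,v_n$ and tokens $1,\dots,n$, one per vertex; a swap exchanges the tokens on the endpoints of an edge; a sorting swap sequence brings token $i$ to $v_i$ for all $i$. -}

module Defs where

open import Data.Nat using (ℕ; _<_; zero; suc)
open import Data.Fin using (Fin; _≟_; toℕ)
open import Data.Fin.Permutation using (Permutation′; _⟨$⟩ʳ_)
open import Data.List using (List; []; _∷_; length; lookup)
open import Data.Product using (Σ; _×_; _,_; proj₁; proj₂)
open import Data.Sum using (_⊎_)
open import Relation.Nullary using (¬_; yes; no)
open import Relation.Binary.PropositionalEquality using (_≡_)

-- A simple graph on vertex set Fin n (vertex v_i is i); edges are an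
-- irreflexive symmetric relation.
record Graph (n : ℕ) : Set₁ where
  field
    Adj   : Fin n → Fin n → Set
    sym   : ∀ {u v} → Adj u v → Adj v u
    irrefl : ∀ {u} → ¬ Adj u u

-- A configuration: which token sits on each vertex.
Config : ℕ → Set
Config n = Fin n → Fin n

Swap : ∀ {n} → Graph n → Set
Swap {n} G = Σ (Fin n × Fin n) λ e → Graph.Adj G (proj₁ e) (proj₂ e)

swapConfig : ∀ {n} → Fin n → Fin n → Config n → Config n
swapConfig u v c w with w ≟ u | w ≟ v
... | yes _ | _     = c v
... | no _  | yes _ = c u
... | no _  | no _  = c w

applySwap : ∀ {n} (G : Graph n) → Swap G → Config n → Config n
applySwap G ((u , v) , _) = swapConfig u v

applySeq : ∀ {n} (G : Graph n) → List (Swap G) → Config n → Config n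
applySeq G []       c = c
applySeq G (s ∷ ss) c = applySeq G ss (applySwap G s c)

Sorted : ∀ {n} → Config n → Set
Sorted {n} c = ∀ (v : Fin n) → c v ≡ v

IsSorting : ∀ {n} (G : Graph n) → Config n → List (Swap G) → Set
IsSorting G c ss = Sorted (applySeq G ss c)

IsOptimal : ∀ {n} (G : Graph n) → Config n → List (Swap G) → Set
IsOptimal G c ss =
  IsSorting G c ss × (∀ (ts : List (Swap G)) → IsSorting G c ts → ¬ (length ts < length ss))

-- The configuration just before the k-th swap (the first k swaps applied).
take-apply : ∀ {n} (G : Graph n) → (ss : List (Swap G)) → ℕ → Config n → Config n
take-apply G []       _         c = c
take-apply G (s ∷ ss) zero    c = c
take-apply G (s ∷ ss) (suc k) c = take-apply G ss k (applySwap G s c)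

-- The (unordered) pair of tokens exchanged by the k-th swap, as an ordered pair.
tokensSwapped : ∀ {n} (G : Graph n) → (ss : List (Swap G)) → Fin (length ss) → Config n → Fin n × Fin n
tokensSwapped G ss k c =
  let ((u , v) , _) = lookup ss k
      c′ = take-apply G ss (toℕ k) c
  in (c′ u , c′ v)

SamePair : ∀ {n} → Fin n × Fin n → Fin n × Fin n → Set
SamePair (a , b) (c , d) = ((a ≡ c) × (b ≡ d)) ⊎ ((a ≡ d) × (b ≡ c))

module Submission where

-- On an injective configuration c (a distinct token on every
-- vertex), swapping the tokens on the vertices u and v is the same as
-- post-composing c with the transposition of the two TOKENS c u and c v.
-- Since relabelling tokens commutes with performing swaps, a swap can be
-- moved to the end of a sequence, where it acts as a token transposition.
-- Consequently deleting the k-th swap of a sequence changes its outcome only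
-- by the transposition of the two tokens that swap exchanges, and deleting
-- the i-th and j-th swaps (i < j) changes it by the two corresponding
-- transpositions.  If both swaps exchange the same pair of tokens these
-- transpositions cancel, so the sequence with both swaps removed still sorts
-- the configuration while being two swaps shorter, contradicting optimality.

open import Defs
open import Data.Nat using (ℕ)
open import Data.Fin using (Fin; _<_)
open import Data.Fin.Permutation using (Permutation′; _⟨$⟩ʳ_)
open import Data.List using (List; length)
open import Relation.Nullary using (¬_)

import Data.Nat as Nat
open import Data.Nat.Properties using (m<n+m)
open import Data.Fin using (zero; suc; _≟_)
open import Data.Fin.Permutation using (_⟨$⟩ˡ_; inverseˡ)
open import Data.List using ([]; _∷_; removeAt)
open import Data.List.Properties using (length-removeAt′)
open import Data.Product using (Σ; _×_; _,_; proj₁; proj₂)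
open import Data.Sum using (inj₁; inj₂)
open import Data.Empty using (⊥-elim)
open import Function using (id; _∘_)
open import Function.Definitions using (Injective)
open import Relation.Nullary using (yes; no)
open import Relation.Binary.PropositionalEquality

InjectiveConfig : ∀ {n} → Config n → Set
InjectiveConfig = Injective _≡_ _≡_

permutation-injective : ∀ {n} (σ : Permutation′ n) → InjectiveConfig (σ ⟨$⟩ʳ_)
permutation-injective σ {x} {y} σx≡σy = begin
  x                      ≡⟨ inverseˡ σ ⟨
  σ ⟨$⟩ˡ (σ ⟨$⟩ʳ x)     ≡⟨ cong (σ ⟨$⟩ˡ_) σx≡σy ⟩
  σ ⟨$⟩ˡ (σ ⟨$⟩ʳ y)     ≡⟨ inverseˡ σ ⟩
  y                      ∎
  where open ≡-Reasoning

swap-at-u : ∀ {n} (u v : Fin n) (c : Config n) → swapConfig u v c u ≡ c v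
swap-at-u u v c with u ≟ u
... | yes _    = refl
... | no u≢u  = ⊥-elim (u≢u refl)

swap-at-v : ∀ {n} (u v : Fin n) (c : Config n) → swapConfig u v c v ≡ c u
swap-at-v u v c with v ≟ u | v ≟ v
... | yes v≡u | _       = cong c v≡u
... | no _    | yes _   = refl
... | no _    | no v≢v  = ⊥-elim (v≢v refl)

swap-elsewhere : ∀ {n} (u v : Fin n) (c : Config n) {w} → w ≢ u → w ≢ v →
                 swapConfig u v c w ≡ c w
swap-elsewhere u v c {w} w≢u w≢v with w ≟ u | w ≟ v
... | yes w≡u | _       = ⊥-elim (w≢u w≡u)
... | no _    | yes w≡v = ⊥-elim (w≢v w≡v)
... | no _    | no _    = refl

-- Where a vertex lies relative to the edge u v; used for case analysis
-- without abstracting over the comparisons inside swapConfig.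
data EdgePosition {n} (u v w : Fin n) : Set where
  at-u : w ≡ u → EdgePosition u v w
  at-v : w ≡ v → EdgePosition u v w
  away : w ≢ u → w ≢ v → EdgePosition u v w

edgePosition : ∀ {n} (u v w : Fin n) → EdgePosition u v w
edgePosition u v w with w ≟ u | w ≟ v
... | yes w≡u | _       = at-u w≡u
... | no _    | yes w≡v = at-v w≡v
... | no w≢u  | no w≢v  = away w≢u w≢v

swap-involutive : ∀ {n} (u v : Fin n) (c : Config n) →
                  swapConfig u v (swapConfig u v c) ≗ c
swap-involutive u v c w with edgePosition u v w
... | at-u refl = trans (swap-at-u w v _) (swap-at-v w v c)
... | at-v refl = trans (swap-at-v u w _) (swap-at-u u w c)
... | away w≢u w≢v =
  trans (swap-elsewhere u v _ w≢u w≢v) (swap-elsewhere u v c w≢u w≢v)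

swap-comm : ∀ {n} (u v : Fin n) (c : Config n) → swapConfig u v c ≗ swapConfig v u c
swap-comm u v c w with edgePosition u v w
... | at-u refl = trans (swap-at-u w v c) (sym (swap-at-v v w c))
... | at-v refl = trans (swap-at-v u w c) (sym (swap-at-u w u c))
... | away w≢u w≢v =
  trans (swap-elsewhere u v c w≢u w≢v) (sym (swap-elsewhere v u c w≢v w≢u))

-- Swaps act on vertices, so they commute with relabelling the tokens.
swap-relabel : ∀ {n} (u v : Fin n) (f : Fin n → Fin n) (c : Config n) →
               swapConfig u v (f ∘ c) ≗ f ∘ swapConfig u v c
swap-relabel u v f c w with w ≟ u | w ≟ v
... | yes _ | _     = refl
... | no _  | yes _ = refl
... | no _  | no _  = refl

swap-cong : ∀ {n} (u v : Fin n) {c d : Config n} → c ≗ d →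
            swapConfig u v c ≗ swapConfig u v d
swap-cong u v c≗d w with w ≟ u | w ≟ v
... | yes _ | _     = c≗d v
... | no _  | yes _ = c≗d u
... | no _  | no _  = c≗d w

exchange : ∀ {n} → Fin n → Fin n → Fin n → Fin n
exchange a b = swapConfig a b id

exchange-involutive : ∀ {n} (a b x : Fin n) → exchange a b (exchange a b x) ≡ x
exchange-involutive a b x =
  trans (sym (swap-relabel a b (exchange a b) id x)) (swap-involutive a b id x)

swap-as-exchange : ∀ {n} (u v : Fin n) {c : Config n} → InjectiveConfig c →
                   swapConfig u v c ≗ exchange (c u) (c v) ∘ c
swap-as-exchange u v {c} c-inj w with edgePosition u v w
... | at-u refl = trans (swap-at-u w v c) (sym (swap-at-u (c w) (c v) id))
... | at-v refl = trans (swap-at-v u w c) (sym (swap-at-v (c u) (c w) id))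
... | away w≢u w≢v = trans (swap-elsewhere u v c w≢u w≢v)
  (sym (swap-elsewhere (c u) (c v) id (w≢u ∘ c-inj) (w≢v ∘ c-inj)))

swap-injective : ∀ {n} (u v : Fin n) {c : Config n} → InjectiveConfig c →
                 InjectiveConfig (swapConfig u v c)
swap-injective u v {c} c-inj {x} {y} eq = c-inj (begin
  c x                     ≡⟨ exchange-involutive (c u) (c v) (c x) ⟨
  τ (τ (c x))             ≡⟨ cong τ (swap-as-exchange u v c-inj x) ⟨
  τ (swapConfig u v c x)  ≡⟨ cong τ eq ⟩
  τ (swapConfig u v c y)  ≡⟨ cong τ (swap-as-exchange u v c-inj y) ⟩
  τ (τ (c y))             ≡⟨ exchange-involutive (c u) (c v) (c y) ⟩
  c y                     ∎)
  where
  open ≡-Reasoning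
  τ = exchange (c u) (c v)

samePair-exchange : ∀ {n} (p q : Fin n × Fin n) → SamePair p q →
                    exchange (proj₁ p) (proj₂ p) ≗ exchange (proj₁ q) (proj₂ q)
samePair-exchange _ _ (inj₁ (refl , refl)) x = refl
samePair-exchange _ _ (inj₂ (refl , refl)) x = swap-comm _ _ id x

module _ {n : ℕ} (G : Graph n) where

  applySeq-cong : ∀ (ss : List (Swap G)) {c d : Config n} → c ≗ d →
                  applySeq G ss c ≗ applySeq G ss d
  applySeq-cong []                   c≗d = c≗d
  applySeq-cong (((u , v) , _) ∷ ss) c≗d = applySeq-cong ss (swap-cong u v c≗d)

  applySeq-relabel : ∀ (ss : List (Swap G)) (f : Fin n → Fin n) (c : Config n) →
                     applySeq G ss (f ∘ c) ≗ f ∘ applySeq G ss c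
  applySeq-relabel []                   f c w = refl
  applySeq-relabel (((u , v) , _) ∷ ss) f c w =
    trans (applySeq-cong ss (swap-relabel u v f c) w)
          (applySeq-relabel ss f (swapConfig u v c) w)

  applySeq-after-swap : ∀ (ss : List (Swap G)) (u v : Fin n) {c : Config n} →
                        InjectiveConfig c →
                        applySeq G ss (swapConfig u v c) ≗
                          exchange (c u) (c v) ∘ applySeq G ss c
  applySeq-after-swap ss u v {c} c-inj w =
    trans (applySeq-cong ss (swap-as-exchange u v c-inj) w)
          (applySeq-relabel ss (exchange (c u) (c v)) c w)

  exchangeAt : ∀ (ss : List (Swap G)) → Fin (length ss) → Config n → Fin n → Fin n
  exchangeAt ss k c =
    exchange (proj₁ (tokensSwapped G ss k c)) (proj₂ (tokensSwapped G ss k c))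

  removeAt-outcome : ∀ (ss : List (Swap G)) (k : Fin (length ss)) {c : Config n} →
                     InjectiveConfig c →
                     applySeq G (removeAt ss k) c ≗ exchangeAt ss k c ∘ applySeq G ss c
  removeAt-outcome (((u , v) , _) ∷ ss) zero {c} c-inj w = begin
    applySeq G ss c w                       ≡⟨ exchange-involutive (c u) (c v) _ ⟨
    τ (τ (applySeq G ss c w))               ≡⟨ cong τ (applySeq-after-swap ss u v c-inj w) ⟨
    τ (applySeq G ss (swapConfig u v c) w)  ∎
    where
    open ≡-Reasoning
    τ = exchange (c u) (c v)
  removeAt-outcome (((u , v) , _) ∷ ss) (suc k) c-inj =
    removeAt-outcome ss k (swap-injective u v c-inj)

  removePair-outcome : ∀ (ss : List (Swap G)) (i j : Fin (length ss)) → i < j →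
                       {c : Config n} → InjectiveConfig c →
                       Σ (List (Swap G)) λ ts →
                         length ss ≡ 2 Nat.+ length ts ×
                         exchangeAt ss i c ∘ applySeq G ts c ≗
                           exchangeAt ss j c ∘ applySeq G ss c
  removePair-outcome (((u , v) , _) ∷ ss) zero (suc j) _ {c} c-inj =
    removeAt ss j , cong Nat.suc (length-removeAt′ ss j) , λ w →
      trans (sym (applySeq-after-swap (removeAt ss j) u v c-inj w))
            (removeAt-outcome ss j (swap-injective u v c-inj) w)
  removePair-outcome (s@((u , v) , _) ∷ ss) (suc i) (suc j) (Nat.s≤s i<j) c-inj
    with removePair-outcome ss i j i<j (swap-injective u v c-inj)
  ... | ts , ts-length , ts-outcome = s ∷ ts , cong Nat.suc ts-length , ts-outcome

  removePair-sorting : ∀ (ss : List (Swap G)) (i j : Fin (length ss)) → i < j →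
                       {c : Config n} → InjectiveConfig c → IsSorting G c ss →
                       SamePair (tokensSwapped G ss i c) (tokensSwapped G ss j c) →
                       Σ (List (Swap G)) λ ts →
                         length ss ≡ 2 Nat.+ length ts × IsSorting G c ts
  removePair-sorting ss i j i<j {c} c-inj sorted same
    with removePair-outcome ss i j i<j c-inj
  ... | ts , ts-length , ts-outcome = ts , ts-length , λ w → begin
    applySeq G ts c w            ≡⟨ exchange-involutive _ _ _ ⟨
    τᵢ (τᵢ (applySeq G ts c w))  ≡⟨ cong τᵢ (ts-outcome w) ⟩
    τᵢ (τⱼ (applySeq G ss c w))  ≡⟨ cong (τᵢ ∘ τⱼ) (sorted w) ⟩
    τᵢ (τⱼ w)                    ≡⟨ cong τᵢ (samePair-exchange _ _ same w) ⟨
    τᵢ (τᵢ w)                    ≡⟨ exchange-involutive _ _ _ ⟩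
    w                            ∎
    where
    open ≡-Reasoning
    τᵢ = exchangeAt ss i c
    τⱼ = exchangeAt ss j c

claim7p3 : ∀ (n : ℕ) (G : Graph n) (σ : Permutation′ n) (ss : List (Swap G)) →
    IsOptimal G (σ ⟨$⟩ʳ_) ss →
    ∀ (i j : Fin (length ss)) → i < j →
    ¬ SamePair (tokensSwapped G ss i (σ ⟨$⟩ʳ_)) (tokensSwapped G ss j (σ ⟨$⟩ʳ_))
claim7p3 n G σ ss (sorted , optimal) i j i<j same
  with removePair-sorting G ss i j i<j (permutation-injective σ) sorted same
... | ts , ts-length , ts-sorted =
  optimal ts ts-sorted (subst (length ts Nat.<_) (sym ts-length) (m<n+m (length ts) Nat.z<s))
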